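{- Let $c\ge 3$, $b\ge 1$ be integers. Then $b+c$ is an eigenvalue of the clique edge up-Laplacian $\delta_1^T\delta_1$ of $G_{c,b}$, and $\binom{c}{2}$ linearly independent eigenvectors for the eigenvalue $b+c$ are $$w_{x,y}=e_{\{x,y\}}+\frac1b\sum_{i=c+1}^{b+c}\left(-e_{\{x,i\}}+e_{\{y,i\}}\right)$$ for $x,y\in\{1,\dots,c\}$, $x<y$.
   Context: $G_{c,b}$ is the graph on vertex set $\{1,\dots,b+c\}$ (natural order) with edges $\{i,j\}$ for $1\le i<j\le c$ and $\{i,j\}$ for $c+1\le i\le c+b$, $1\le j\le c$. $\mathcal T_{c,b}$ is the set of all triangles of $G_{c,b}$, and $e_{f}$ denotes the standard basis vector of $\mathbb R^{E(G_{c,b})}$ indexed by the edge $f$. For $T=\{p,q,r\}$ with $p<q<r$ and an edge $f$, $[T:f]$ is $1$ if $f=\{p,q\}$ or $\{q,r\}$, $-1$ if $f=\{p,r\}$, $0$ if $f\not\subset T$; $\delta_1$ is the $\mathcal T_{c,b}\times E(G_{c,b})$ matrix with entries $[T:f]$.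
   Formalization: Vectors in $\mathbb R^{E(G_{c,b})}$ have rational entries, and the linear independence of the $w_{x,y}$ is asserted only for rational coefficients rather than real ones. -}

module Defs where

open import Data.Bool using (Bool; true; false; _∧_; _∨_; if_then_else_)
open import Data.Nat as ℕ using (ℕ; zero; suc; _<ᵇ_; _≤ᵇ_; _≡ᵇ_)
open import Data.Integer using (+_)
open import Data.Product using (_×_; _,_)
open import Data.List using (List; []; _∷_; map; upTo; filter; concatMap; foldr)
open import Data.Rational using (ℚ; 0ℚ; 1ℚ; _+_; _*_; -_; _/_)
open import Relation.Binary.PropositionalEquality using (_≡_; refl)

-- vertices are the natural numbers 1 .. b + c
-- [a .. n]  =  a, a+1, ..., n   (list of naturals)
range : ℕ → ℕ → List ℕ
range a n = map (ℕ._+ a) (upTo (suc n ℕ.∸ a))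

adj : ℕ → ℕ → ℕ → ℕ → Bool
adj c b i j =
  ((1 ≤ᵇ i) ∧ (i <ᵇ j) ∧ (j ≤ᵇ c)) ∨
  ((suc c ≤ᵇ i) ∧ (i ≤ᵇ c ℕ.+ b) ∧ (1 ≤ᵇ j) ∧ (j ≤ᵇ c))

isEdge : ℕ → ℕ → ℕ → ℕ → Bool
isEdge c b i j = adj c b i j ∨ adj c b j i

-- an edge {p,q} (p < q) is represented by the ordered pair (p , q)
Edge : Set
Edge = ℕ × ℕ

-- a triangle {p,q,r} (p < q < r) is represented by the triple (p , q , r)
Triangle : Set
Triangle = ℕ × ℕ × ℕ

edges : ℕ → ℕ → List Edge
edges c b = concatMap (λ p → concatMap (λ q →
    if (p <ᵇ q) ∧ isEdge c b p q then (p , q) ∷ [] else [])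
  (range 1 (b ℕ.+ c))) (range 1 (b ℕ.+ c))

triangles : ℕ → ℕ → List Triangle
triangles c b = concatMap (λ p → concatMap (λ q → concatMap (λ r →
    if (p <ᵇ q) ∧ (q <ᵇ r) ∧ isEdge c b p q ∧ isEdge c b q r ∧ isEdge c b p r
    then (p , q , r) ∷ [] else [])
  (range 1 (b ℕ.+ c))) (range 1 (b ℕ.+ c))) (range 1 (b ℕ.+ c))

sumℚ : List ℚ → ℚ
sumℚ = foldr _+_ 0ℚ

eqE : Edge → Edge → Bool
eqE (u , v) (u' , v') = (u ≡ᵇ u') ∧ (v ≡ᵇ v')

incid : Triangle → Edge → ℚ
incid (p , q , r) f =
  if eqE f (p , q) ∨ eqE f (q , r) then 1ℚ
  else if eqE f (p , r) then - 1ℚ else 0ℚ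

-- vectors in ℝ^{E(G_{c,b})} (over ℚ): only values on edges matter
EVec : Set
EVec = Edge → ℚ

TVec : Set
TVec = Triangle → ℚ

δ₁ : ℕ → ℕ → EVec → TVec
δ₁ c b v T = sumℚ (map (λ g → incid T g * v g) (edges c b))

δ₁ᵀ : ℕ → ℕ → TVec → EVec
δ₁ᵀ c b u f = sumℚ (map (λ T → incid T f * u T) (triangles c b))

upLap : ℕ → ℕ → EVec → EVec
upLap c b v = δ₁ᵀ c b (δ₁ c b v)

basis : Edge → EVec
basis f g = if eqE g f then 1ℚ else 0ℚ

_+ᵥ_ : EVec → EVec → EVec
(v +ᵥ w) f = v f + w f

_·ᵥ_ : ℚ → EVec → EVec
(a ·ᵥ v) f = a * v f

0ᵥ : EVec
0ᵥ f = 0ℚ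

sumᵥ : List EVec → EVec
sumᵥ = foldr _+ᵥ_ 0ᵥ

-- 1/n as a rational (for n = 0 the value is irrelevant; used only with n ≥ 1)
invℕ : ℕ → ℚ
invℕ zero = 0ℚ
invℕ (suc n) = (+ 1) / suc n

fromℕ : ℕ → ℚ
fromℕ n = (+ n) / 1

_≐[_,_]_ : EVec → ℕ → ℕ → EVec → Set
v ≐[ c , b ] w = ∀ f → f Data.List.Membership.Propositional.∈ edges c b → v f ≡ w f
  where import Data.List.Membership.Propositional

cliquePairs : ℕ → List (ℕ × ℕ)
cliquePairs c = concatMap (λ x → concatMap (λ y →
    if x <ᵇ y then (x , y) ∷ [] else []) (range 1 c)) (range 1 c)

wvec : ℕ → ℕ → ℕ → ℕ → EVec
wvec c b x y = basis (x , y) +ᵥ (invℕ b ·ᵥ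
  sumᵥ (map (λ i → ((- 1ℚ) ·ᵥ basis (x , i)) +ᵥ basis (y , i)) (range (suc c) (b ℕ.+ c))))

-- Extend w = w_{x,y} to the alternating function ω = δ_x ∧ δ_y + (1/b) ξ ∧ ι on pairs of vertices,
-- where δ_z is the indicator of the vertex z, ξ = δ_y − δ_x, ι is the indicator of the independent
-- set I = {c+1, …, b+c}, and (α ∧ β)(s, t) = α(s) β(t) − α(t) β(s).  Every triangle {u, v, r} through
-- an edge u < v contributes ω(u,v) + ω(v,r) − ω(u,r) to (δ₁ᵀδ₁ w)(u,v), whatever the position of r,
-- so (δ₁ᵀδ₁ w)(u,v) is the sum of these terms over the common neighbours r of u and v.  The partial
-- divergences of ω are Σ_{r ≤ c} ω(a,r) = −ξ(a) and Σ_{r ∈ I} ω(a,r) = ξ(a).  On a clique edge all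
-- other vertices are common neighbours and the two divergences cancel, leaving (b + c) ω(u,v); on an
-- edge with u ≤ c < v the common neighbours are the other clique vertices, and ξ(u) = b ω(u,v)
-- supplies the missing b ω(u,v).  On clique edges w_{x,y} is the basis vector e_{xy}, which gives
-- linear independence.

module Submission where

open import Data.Bool using (Bool; true; false; if_then_else_; not; _∧_; _∨_)
open import Data.Bool.Properties using (T-≡; ∨-comm; ∧-comm; ∧-identityʳ; ∧-zeroʳ)
open import Data.Nat as ℕ using (ℕ; zero; suc; _≤_; _<_; _≡ᵇ_; _≤ᵇ_; _<ᵇ_; _∸_; s≤s; z≤n)
import Data.Nat.Properties as ℕP
open import Data.Nat.Combinatorics using (_C_; nC1≡n; nCk+nC[k+1]≡[n+1]C[k+1])
open import Data.Nat.Coprimality using (1-coprimeTo) renaming (sym to coprime-sym)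
import Data.Integer as ℤ
import Data.Integer.Properties as ℤP
open import Data.Rational using (ℚ; mkℚ; 0ℚ; 1ℚ; _+_; _*_; -_; _-_; _/_)
import Data.Rational.Properties as ℚP
open import Data.Rational.Solver using (module +-*-Solver)
open import Data.Product using (_×_; _,_; proj₁; proj₂; ∃)
import Data.Product
open import Data.Sum using (inj₁; inj₂)
open import Data.List using (List; []; _∷_; _++_; map; concatMap; length; applyUpTo)
open import Data.List.Properties using (map-upTo; length-applyUpTo; length-++; concatMap-++; ++-identityʳ)
open import Data.List.Membership.Propositional using (_∈_; _∉_; find; lose)
open import Data.List.Membership.Propositional.Properties using (∈-applyUpTo⁺; ∈-applyUpTo⁻; ∈-++⁻)
import Data.List.Relation.Unary.All.Properties as All
open import Data.List.Relation.Unary.Any using (here; there)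
open import Data.List.Relation.Unary.Any.Properties using (concatMap⁺; concatMap⁻)
open import Data.List.Relation.Unary.Unique.Propositional using (Unique; []; _∷_)
open import Data.List.Relation.Unary.Unique.Propositional.Properties using (applyUpTo⁺₁)
open import Function using (_∘_)
open import Function.Bundles using (Equivalence)
open import Relation.Binary.Definitions using (tri<; tri≈; tri>)
open import Relation.Binary.PropositionalEquality
open import Relation.Nullary using (proof; ofʸ; ofⁿ; Reflects; contradiction; yes; no)
open +-*-Solver using (solve; _:+_; _:-_; _:*_; :-_; _:=_; con)

open import Defs

private variable A B : Set

fromℕ-mkℚ : ∀ n → fromℕ n ≡ mkℚ (ℤ.+ n) 0 (coprime-sym (1-coprimeTo n))
fromℕ-mkℚ n = ℚP.normalize-coprime (coprime-sym (1-coprimeTo n))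

fromℕ-suc : ∀ n → fromℕ (suc n) ≡ 1ℚ + fromℕ n
fromℕ-suc n rewrite fromℕ-mkℚ n = cong (_/ 1) (cong (ℤ._+_ (ℤ.+ 1)) (sym (ℤP.*-identityʳ (ℤ.+ n))))

fromℕ-+ : ∀ m n → fromℕ (m ℕ.+ n) ≡ fromℕ m + fromℕ n
fromℕ-+ zero    n = sym (ℚP.+-identityˡ (fromℕ n))
fromℕ-+ (suc m) n rewrite fromℕ-suc (m ℕ.+ n) | fromℕ-suc m | fromℕ-+ m n =
  sym (ℚP.+-assoc 1ℚ (fromℕ m) (fromℕ n))

fromℕ-*-invℕ : ∀ n → fromℕ (suc n) * invℕ (suc n) ≡ 1ℚ
fromℕ-*-invℕ n rewrite fromℕ-mkℚ (suc n) | ℚP.normalize-coprime {1} {n} (1-coprimeTo (suc n)) =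
  ℚP.*-inverseʳ (mkℚ (ℤ.+ suc n) 0 (coprime-sym (1-coprimeTo (suc n))))

≡ᵇ-reflects : ∀ m n → Reflects (m ≡ n) (m ≡ᵇ n)
≡ᵇ-reflects m n = proof (m ℕP.≟ n)

≡ᵇ-refl : ∀ n → (n ≡ᵇ n) ≡ true
≡ᵇ-refl n = Equivalence.to T-≡ (ℕP.≡⇒≡ᵇ n n refl)

≡ᵇ-sym : ∀ m n → (m ≡ᵇ n) ≡ (n ≡ᵇ m)
≡ᵇ-sym zero    zero    = refl
≡ᵇ-sym zero    (suc n) = refl
≡ᵇ-sym (suc m) zero    = refl
≡ᵇ-sym (suc m) (suc n) = ≡ᵇ-sym m n

≡ᵇ-false : ∀ {m n} → m ≢ n → (m ≡ᵇ n) ≡ false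
≡ᵇ-false {m} {n} m≢n with m ≡ᵇ n | ≡ᵇ-reflects m n
... | true  | ofʸ m≡n = contradiction m≡n m≢n
... | false | ofⁿ _   = refl

≡ᵇ-true⁻ : ∀ {m n} → (m ≡ᵇ n) ≡ true → m ≡ n
≡ᵇ-true⁻ {m} {n} eq = ℕP.≡ᵇ⇒≡ m n (Equivalence.from T-≡ eq)

<ᵇ-true : ∀ {m n} → m < n → (m <ᵇ n) ≡ true
<ᵇ-true m<n = Equivalence.to T-≡ (ℕP.<⇒<ᵇ m<n)

<ᵇ-true⁻ : ∀ {m n} → (m <ᵇ n) ≡ true → m < n
<ᵇ-true⁻ {m} {n} eq = ℕP.<ᵇ⇒< m n (Equivalence.from T-≡ eq)

<ᵇ-false : ∀ {m n} → n ≤ m → (m <ᵇ n) ≡ false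
<ᵇ-false {m} {n} n≤m with m <ᵇ n | ℕP.<ᵇ-reflects-< m n
... | true  | ofʸ m<n = contradiction n≤m (ℕP.<⇒≱ m<n)
... | false | ofⁿ _   = refl

≤ᵇ-true : ∀ {m n} → m ≤ n → (m ≤ᵇ n) ≡ true
≤ᵇ-true m≤n = Equivalence.to T-≡ (ℕP.≤⇒≤ᵇ m≤n)

≤ᵇ-false : ∀ {m n} → n < m → (m ≤ᵇ n) ≡ false
≤ᵇ-false {m} {n} n<m with m ≤ᵇ n | ℕP.≤ᵇ-reflects-≤ m n
... | true  | ofʸ m≤n = contradiction m≤n (ℕP.<⇒≱ n<m)
... | false | ofⁿ _   = refl

<ᵇ-not-≤ᵇ : ∀ m n → (m <ᵇ n) ≡ not (n ≤ᵇ m)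
<ᵇ-not-≤ᵇ m n with m <ᵇ n | ℕP.<ᵇ-reflects-< m n | n ≤ᵇ m | ℕP.≤ᵇ-reflects-≤ n m
... | true  | ofʸ m<n | true  | ofʸ n≤m = contradiction n≤m (ℕP.<⇒≱ m<n)
... | true  | ofʸ _   | false | ofⁿ _   = refl
... | false | ofⁿ _   | true  | ofʸ _   = refl
... | false | ofⁿ m≮n | false | ofⁿ n≰m = contradiction (ℕP.≰⇒> n≰m) m≮n

∧-true⁻ : ∀ {a b} → a ∧ b ≡ true → a ≡ true × b ≡ true
∧-true⁻ {true} b≡true = refl , b≡true

eqE-true⁻ : ∀ {s t a b} → eqE (s , t) (a , b) ≡ true → s ≡ a × t ≡ b
eqE-true⁻ eq with ∧-true⁻ eq
... | s≡a , t≡b = ≡ᵇ-true⁻ s≡a , ≡ᵇ-true⁻ t≡b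

eqE-sym : ∀ e f → eqE e f ≡ eqE f e
eqE-sym (s , t) (p , q) = cong₂ _∧_ (≡ᵇ-sym s p) (≡ᵇ-sym t q)

-- Finite sums

∑ : List A → (A → ℚ) → ℚ
∑ []       f = 0ℚ
∑ (x ∷ xs) f = f x + ∑ xs f

syntax ∑ xs (λ x → t) = ∑[ x ∈ xs ] t

when : Bool → ℚ → ℚ
when b t = if b then t else 0ℚ

𝟙 : Bool → ℚ
𝟙 b = when b 1ℚ

∑-++ : ∀ (xs ys : List A) f → ∑ (xs ++ ys) f ≡ ∑ xs f + ∑ ys f
∑-++ []       ys f = sym (ℚP.+-identityˡ _)
∑-++ (x ∷ xs) ys f rewrite ∑-++ xs ys f = sym (ℚP.+-assoc (f x) _ _)

∑-concatMap : ∀ (g : A → List B) xs f → ∑ (concatMap g xs) f ≡ ∑[ x ∈ xs ] ∑ (g x) f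
∑-concatMap g []       f = refl
∑-concatMap g (x ∷ xs) f = trans (∑-++ (g x) _ f) (cong (∑ (g x) f +_) (∑-concatMap g xs f))

∑-cong : ∀ (xs : List A) {f g} → (∀ {x} → x ∈ xs → f x ≡ g x) → ∑ xs f ≡ ∑ xs g
∑-cong []       eq = refl
∑-cong (x ∷ xs) eq = cong₂ _+_ (eq (here refl)) (∑-cong xs (eq ∘ there))

∑-+ : ∀ (xs : List A) f g → ∑[ x ∈ xs ] (f x + g x) ≡ ∑ xs f + ∑ xs g
∑-+ []       f g = refl
∑-+ (x ∷ xs) f g rewrite ∑-+ xs f g =
  solve 4 (λ a b s t → (a :+ b) :+ (s :+ t) := (a :+ s) :+ (b :+ t)) refl (f x) (g x) (∑ xs f) (∑ xs g)

∑-*ˡ : ∀ (xs : List A) k f → ∑[ x ∈ xs ] (k * f x) ≡ k * ∑ xs f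
∑-*ˡ []       k f = sym (ℚP.*-zeroʳ k)
∑-*ˡ (x ∷ xs) k f rewrite ∑-*ˡ xs k f = sym (ℚP.*-distribˡ-+ k (f x) (∑ xs f))

∑-*ʳ : ∀ (xs : List A) k f → ∑[ x ∈ xs ] (f x * k) ≡ ∑ xs f * k
∑-*ʳ xs k f = trans (∑-cong xs (λ {x} _ → ℚP.*-comm (f x) k)) (trans (∑-*ˡ xs k f) (ℚP.*-comm k (∑ xs f)))

∑-neg : ∀ (xs : List A) f → ∑[ x ∈ xs ] (- f x) ≡ - ∑ xs f
∑-neg []       f = refl
∑-neg (x ∷ xs) f rewrite ∑-neg xs f = sym (ℚP.neg-distrib-+ (f x) (∑ xs f))

∑-- : ∀ (xs : List A) f g → ∑[ x ∈ xs ] (f x - g x) ≡ ∑ xs f - ∑ xs g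
∑-- xs f g = trans (∑-+ xs f (λ x → - g x)) (cong (∑ xs f +_) (∑-neg xs g))

∑-+- : ∀ (xs : List A) f g h → ∑[ x ∈ xs ] (f x + g x - h x) ≡ ∑ xs f + ∑ xs g - ∑ xs h
∑-+- xs f g h = trans (∑-- xs (λ x → f x + g x) h) (cong (_- ∑ xs h) (∑-+ xs f g))

∑-+-³ : ∀ (xs : List ℕ) (f g h : ℕ → ℕ → ℕ → ℚ) →
  ∑[ p ∈ xs ] ∑[ q ∈ xs ] ∑[ r ∈ xs ] (f p q r + g p q r - h p q r)
    ≡ ∑[ p ∈ xs ] ∑[ q ∈ xs ] ∑[ r ∈ xs ] f p q r + ∑[ p ∈ xs ] ∑[ q ∈ xs ] ∑[ r ∈ xs ] g p q r
      - ∑[ p ∈ xs ] ∑[ q ∈ xs ] ∑[ r ∈ xs ] h p q r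
∑-+-³ xs f g h =
  trans (∑-cong xs (λ {p} _ → trans (∑-cong xs (λ {q} _ → ∑-+- xs (f p q) (g p q) (h p q)))
                                    (∑-+- xs (λ q → ∑ xs (f p q)) (λ q → ∑ xs (g p q)) (λ q → ∑ xs (h p q)))))
        (∑-+- xs (λ p → ∑[ q ∈ xs ] ∑ xs (f p q)) (λ p → ∑[ q ∈ xs ] ∑ xs (g p q))
                 (λ p → ∑[ q ∈ xs ] ∑ xs (h p q)))

∑-const : ∀ (xs : List A) k → ∑[ x ∈ xs ] k ≡ fromℕ (length xs) * k
∑-const []       k = sym (ℚP.*-zeroˡ k)
∑-const (x ∷ xs) k rewrite ∑-const xs k | fromℕ-suc (length xs) =
  solve 2 (λ k n → k :+ n :* k := (con 1ℚ :+ n) :* k) refl k (fromℕ (length xs))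

∑-zero : ∀ (xs : List A) → ∑[ x ∈ xs ] 0ℚ ≡ 0ℚ
∑-zero xs = trans (∑-const xs 0ℚ) (ℚP.*-zeroʳ (fromℕ (length xs)))

∑-when : ∀ (xs : List A) b f → ∑[ x ∈ xs ] when b (f x) ≡ when b (∑ xs f)
∑-when xs true  f = refl
∑-when xs false f = ∑-zero xs

sumℚ-map : ∀ (xs : List A) f → sumℚ (map f xs) ≡ ∑ xs f
sumℚ-map []       f = refl
sumℚ-map (x ∷ xs) f = cong (f x +_) (sumℚ-map xs f)

sumᵥ-map : ∀ (F : A → EVec) xs g → sumᵥ (map F xs) g ≡ ∑[ x ∈ xs ] F x g
sumᵥ-map F []       g = refl
sumᵥ-map F (x ∷ xs) g = cong (F x g +_) (sumᵥ-map F xs g)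

when-0 : ∀ a → when a 0ℚ ≡ 0ℚ
when-0 true  = refl
when-0 false = refl

when-∧ : ∀ a b x → when (a ∧ b) x ≡ when a (when b x)
when-∧ true  b x = refl
when-∧ false b x = refl

when-swap : ∀ a b x → when a (when b x) ≡ when b (when a x)
when-swap true  b x = refl
when-swap false b x = sym (when-0 b)

when-cong : ∀ a {x y} → (a ≡ true → x ≡ y) → when a x ≡ when a y
when-cong true  x≡y = x≡y refl
when-cong false x≡y = refl

when-neg : ∀ a x → when a (- x) ≡ - when a x
when-neg true  x = refl
when-neg false x = refl

𝟙-* : ∀ a x → 𝟙 a * x ≡ when a x
𝟙-* true  x = ℚP.*-identityˡ x
𝟙-* false x = ℚP.*-zeroˡ x

𝟙-∧ : ∀ a b → 𝟙 (a ∧ b) ≡ 𝟙 a * 𝟙 b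
𝟙-∧ true  b = sym (ℚP.*-identityˡ (𝟙 b))
𝟙-∧ false b = sym (ℚP.*-zeroˡ (𝟙 b))

𝟙-combination : ∀ a b c x → (𝟙 a + 𝟙 b - 𝟙 c) * x ≡ when a x + when b x - when c x
𝟙-combination a b c x = begin
  (𝟙 a + 𝟙 b - 𝟙 c) * x
    ≡⟨ solve 4 (λ A B C X → (A :+ B :- C) :* X := A :* X :+ B :* X :- C :* X) refl (𝟙 a) (𝟙 b) (𝟙 c) x ⟩
  𝟙 a * x + 𝟙 b * x - 𝟙 c * x
    ≡⟨ cong₂ _-_ (cong₂ _+_ (𝟙-* a x) (𝟙-* b x)) (𝟙-* c x) ⟩
  when a x + when b x - when c x ∎
  where open ≡-Reasoning

∑-absent : ∀ {xs : List ℕ} {k} (f : ℕ → ℚ) → k ∉ xs → ∑[ i ∈ xs ] when (k ≡ᵇ i) (f i) ≡ 0ℚ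
∑-absent {xs} {k} f k∉xs = trans (∑-cong xs vanish) (∑-zero xs)
  where
  vanish : ∀ {i} → i ∈ xs → when (k ≡ᵇ i) (f i) ≡ 0ℚ
  vanish {i} i∈xs with k ≡ᵇ i | ≡ᵇ-reflects k i
  ... | true  | ofʸ refl = contradiction i∈xs k∉xs
  ... | false | ofⁿ _    = refl

∑-pick : ∀ {xs : List ℕ} {k} (f : ℕ → ℚ) → Unique xs → k ∈ xs → ∑[ i ∈ xs ] when (k ≡ᵇ i) (f i) ≡ f k
∑-pick {xs = x ∷ xs} {k} f (x∉xs ∷ uniq) k∈ with k ≡ᵇ x | ≡ᵇ-reflects k x | k∈
... | true  | ofʸ refl | _         = trans (cong (f k +_) (∑-absent f (All.All¬⇒¬Any x∉xs))) (ℚP.+-identityʳ (f k))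
... | false | ofⁿ k≢x | here k≡x  = contradiction k≡x k≢x
... | false | ofⁿ k≢x | there k∈ = trans (ℚP.+-identityˡ _) (∑-pick f uniq k∈)

∑-pick₂ : ∀ {xs : List ℕ} {u v} (F : ℕ → ℕ → ℚ) → Unique xs → u ∈ xs → v ∈ xs →
          ∑[ p ∈ xs ] ∑[ q ∈ xs ] when ((u ≡ᵇ p) ∧ (v ≡ᵇ q)) (F p q) ≡ F u v
∑-pick₂ {xs} {u} {v} F uniq u∈ v∈ = begin
  ∑[ p ∈ xs ] ∑[ q ∈ xs ] when ((u ≡ᵇ p) ∧ (v ≡ᵇ q)) (F p q)
    ≡⟨ ∑-cong xs (λ {p} _ → trans (∑-cong xs (λ {q} _ → when-∧ (u ≡ᵇ p) (v ≡ᵇ q) (F p q)))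
                                  (∑-when xs (u ≡ᵇ p) _)) ⟩
  ∑[ p ∈ xs ] when (u ≡ᵇ p) (∑[ q ∈ xs ] when (v ≡ᵇ q) (F p q))
    ≡⟨ ∑-pick _ uniq u∈ ⟩
  ∑[ q ∈ xs ] when (v ≡ᵇ q) (F u q)
    ≡⟨ ∑-pick _ uniq v∈ ⟩
  F u v ∎
  where open ≡-Reasoning

range-applyUpTo : ∀ a n → range a n ≡ applyUpTo (ℕ._+ a) (suc n ∸ a)
range-applyUpTo a n = map-upTo (ℕ._+ a) (suc n ∸ a)

∈-range⁺ : ∀ {a n i} → a ≤ i → i ≤ n → i ∈ range a n
∈-range⁺ {a} {n} {i} a≤i i≤n rewrite range-applyUpTo a n =
  subst (_∈ _) (ℕP.m∸n+n≡m a≤i) (∈-applyUpTo⁺ (ℕ._+ a) (ℕP.∸-monoˡ-< (s≤s i≤n) a≤i))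

∈-range⁻ : ∀ {a n i} → i ∈ range a n → a ≤ i × i ≤ n
∈-range⁻ {a} {n} {i} i∈ rewrite range-applyUpTo a n with ∈-applyUpTo⁻ (ℕ._+ a) i∈
... | j , j<m , refl = ℕP.m≤n+m a j , ℕP.≤-pred (ℕP.m≤o∸n⇒m+n≤o (suc j) a≤1+n j<m)
  where
  a≤1+n : a ≤ suc n
  a≤1+n = ℕP.<⇒≤ (ℕP.m∸n≢0⇒n<m (ℕP.m>n⇒m∸n≢0 (ℕP.≤-trans (s≤s z≤n) j<m)))

range-unique : ∀ a n → Unique (range a n)
range-unique a n rewrite range-applyUpTo a n =
  applyUpTo⁺₁ (ℕ._+ a) (suc n ∸ a) (λ i<j _ i+a≡j+a → ℕP.<⇒≢ i<j (ℕP.+-cancelʳ-≡ _ _ _ i+a≡j+a))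

length-range : ∀ a n → length (range a n) ≡ suc n ∸ a
length-range a n rewrite range-applyUpTo a n = length-applyUpTo (ℕ._+ a) (suc n ∸ a)

applyUpTo-+ : ∀ (f g : ℕ → ℕ) m k → (∀ i → g i ≡ f (m ℕ.+ i)) →
              applyUpTo f (m ℕ.+ k) ≡ applyUpTo f m ++ applyUpTo g k
applyUpTo-+ f g zero    zero    g≗ = refl
applyUpTo-+ f g zero    (suc k) g≗ =
  cong₂ _∷_ (sym (g≗ 0)) (applyUpTo-+ (λ i → f (suc i)) (λ i → g (suc i)) zero k (λ i → g≗ (suc i)))
applyUpTo-+ f g (suc m) k       g≗ = cong (f 0 ∷_) (applyUpTo-+ (λ i → f (suc i)) g m k g≗)

range-split : ∀ m k → range 1 (k ℕ.+ m) ≡ range 1 m ++ range (suc m) (k ℕ.+ m)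
range-split m k rewrite range-applyUpTo 1 (k ℕ.+ m) | range-applyUpTo 1 m | range-applyUpTo (suc m) (k ℕ.+ m)
                      | ℕP.m+n∸n≡m k m | ℕP.+-comm k m =
  applyUpTo-+ (ℕ._+ 1) (ℕ._+ suc m) m k (λ i → trans (ℕP.+-comm i (suc m)) (ℕP.+-comm 1 (m ℕ.+ i)))

range-last : ∀ n → range 1 (suc n) ≡ range 1 n ++ suc n ∷ []
range-last n = trans (range-split n 1) (cong (range 1 n ++_) singleton)
  where
  singleton : range (suc n) (suc n) ≡ suc n ∷ []
  singleton rewrite range-applyUpTo (suc n) (suc n) | ℕP.m+n∸n≡m 1 (suc n) = refl

∑-𝟙-range : ∀ {a n t} → t ≤ n → ∑[ i ∈ range a n ] 𝟙 (t ≡ᵇ i) ≡ 𝟙 (a ≤ᵇ t)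
∑-𝟙-range {a} {n} {t} t≤n with a ≤ᵇ t | ℕP.≤ᵇ-reflects-≤ a t
... | true  | ofʸ a≤t = ∑-pick (λ _ → 1ℚ) (range-unique a n) (∈-range⁺ a≤t t≤n)
... | false | ofⁿ a≰t = ∑-absent (λ _ → 1ℚ) (a≰t ∘ proj₁ ∘ ∈-range⁻)

pairsFrom : (A → A → Bool) → List A → A → List (A × A)
pairsFrom P ys p = concatMap (λ q → if P p q then (p , q) ∷ [] else []) ys

pairsWith : (A → A → Bool) → List A → List (A × A)
pairsWith P xs = concatMap (pairsFrom P xs) xs

triplesWith : (A → A → A → Bool) → List A → List (A × A × A)
triplesWith P xs =
  concatMap (λ p → concatMap (λ q → concatMap (λ r → if P p q r then (p , q , r) ∷ [] else []) xs) xs) xs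

∑-if : ∀ b (x : A) f → ∑ (if b then x ∷ [] else []) f ≡ when b (f x)
∑-if true  x f = ℚP.+-identityʳ (f x)
∑-if false x f = refl

∑-pairsWith : ∀ P (xs : List A) f → ∑ (pairsWith P xs) f ≡ ∑[ p ∈ xs ] ∑[ q ∈ xs ] when (P p q) (f (p , q))
∑-pairsWith P xs f =
  trans (∑-concatMap (pairsFrom P xs) xs f) (∑-cong xs (λ {p} _ →
  trans (∑-concatMap _ xs f) (∑-cong xs (λ {q} _ → ∑-if (P p q) (p , q) f))))

∑-triplesWith : ∀ P (xs : List A) f →
  ∑ (triplesWith P xs) f ≡ ∑[ p ∈ xs ] ∑[ q ∈ xs ] ∑[ r ∈ xs ] when (P p q r) (f (p , q , r))
∑-triplesWith P xs f =
  trans (∑-concatMap plane xs f) (∑-cong xs (λ {p} _ →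
  trans (∑-concatMap (row p) xs f) (∑-cong xs (λ {q} _ →
  trans (∑-concatMap _ xs f) (∑-cong xs (λ {r} _ → ∑-if (P p q r) (p , q , r) f))))))
  where
  row : _ → _ → List _
  row p q = concatMap (λ r → if P p q r then (p , q , r) ∷ [] else []) xs
  plane : _ → List _
  plane p = concatMap (row p) xs

∈-if⁻ : ∀ b {x y : A} → x ∈ (if b then y ∷ [] else []) → b ≡ true × x ≡ y
∈-if⁻ true (here x≡y) = refl , x≡y

∈-if⁺ : ∀ {b} (x : A) → b ≡ true → x ∈ (if b then x ∷ [] else [])
∈-if⁺ x refl = here refl

∈-pairsWith⁻ : ∀ {P} {xs : List A} {p q} → (p , q) ∈ pairsWith P xs → p ∈ xs × q ∈ xs × P p q ≡ true
∈-pairsWith⁻ {P = P} pq∈ with find (concatMap⁻ _ pq∈)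
... | p′ , p′∈ , pq∈row with find (concatMap⁻ _ pq∈row)
...   | q′ , q′∈ , pq∈if with ∈-if⁻ (P p′ q′) {y = p′ , q′} pq∈if
...     | P≡true , refl = p′∈ , q′∈ , P≡true

∈-pairsWith⁺ : ∀ {P} {xs : List A} {p q} → p ∈ xs → q ∈ xs → P p q ≡ true → (p , q) ∈ pairsWith P xs
∈-pairsWith⁺ p∈ q∈ P≡true = concatMap⁺ _ (lose p∈ (concatMap⁺ _ (lose q∈ (∈-if⁺ _ P≡true))))

∑-pairsWith-pick : ∀ {P} {xs : List ℕ} {s t} (h : ℕ × ℕ → ℚ) → Unique xs → (s , t) ∈ pairsWith P xs →
                   ∑[ g ∈ pairsWith P xs ] when (eqE (s , t) g) (h g) ≡ h (s , t)
∑-pairsWith-pick {P} {xs} {s} {t} h uniq st∈ = let s∈ , t∈ , Pst = ∈-pairsWith⁻ {P = P} st∈ in begin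
  ∑[ g ∈ pairsWith P xs ] when (eqE (s , t) g) (h g)
    ≡⟨ ∑-pairsWith P xs _ ⟩
  ∑[ p ∈ xs ] ∑[ q ∈ xs ] when (P p q) (when (eqE (s , t) (p , q)) (h (p , q)))
    ≡⟨ ∑-cong xs (λ {p} _ → ∑-cong xs (λ {q} _ → when-swap (P p q) (eqE (s , t) (p , q)) (h (p , q)))) ⟩
  ∑[ p ∈ xs ] ∑[ q ∈ xs ] when (eqE (s , t) (p , q)) (when (P p q) (h (p , q)))
    ≡⟨ ∑-pick₂ (λ p q → when (P p q) (h (p , q))) uniq s∈ t∈ ⟩
  when (P s t) (h (s , t))
    ≡⟨ cong (λ a → when a (h (s , t))) Pst ⟩
  h (s , t) ∎
  where open ≡-Reasoning

length-concatMap-suc : ∀ (f g : A → List B) xs → (∀ {x} → x ∈ xs → length (f x) ≡ suc (length (g x))) →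
                       length (concatMap f xs) ≡ length (concatMap g xs) ℕ.+ length xs
length-concatMap-suc f g []       _   = refl
length-concatMap-suc f g (x ∷ xs) len = begin
  length (f x ++ concatMap f xs)
    ≡⟨ length-++ (f x) ⟩
  length (f x) ℕ.+ length (concatMap f xs)
    ≡⟨ cong₂ ℕ._+_ (len (here refl)) (length-concatMap-suc f g xs (len ∘ there)) ⟩
  suc (length (g x)) ℕ.+ (length (concatMap g xs) ℕ.+ length xs)
    ≡⟨ cong suc (sym (ℕP.+-assoc (length (g x)) _ _)) ⟩
  suc (length (g x) ℕ.+ length (concatMap g xs) ℕ.+ length xs)
    ≡⟨ sym (ℕP.+-suc _ (length xs)) ⟩
  length (g x) ℕ.+ length (concatMap g xs) ℕ.+ suc (length xs)
    ≡⟨ cong (ℕ._+ suc (length xs)) (sym (length-++ (g x))) ⟩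
  length (g x ++ concatMap g xs) ℕ.+ suc (length xs) ∎
  where open ≡-Reasoning

pairsFrom-none : ∀ {P : A → A → Bool} {p} ys → (∀ {q} → q ∈ ys → P p q ≡ false) → pairsFrom P ys p ≡ []
pairsFrom-none []       _    = refl
pairsFrom-none {P = P} {p} (q ∷ ys) none rewrite none (here refl) = pairsFrom-none {P = P} ys (none ∘ there)

length-pairsWith-snoc : ∀ P (xs : List A) z → (∀ {p} → p ∈ xs → P p z ≡ true) →
                        (∀ {q} → q ∈ xs ++ z ∷ [] → P z q ≡ false) →
                        length (pairsWith P (xs ++ z ∷ [])) ≡ length (pairsWith P xs) ℕ.+ length xs
length-pairsWith-snoc P xs z below above = begin
  length (concatMap row (xs ++ z ∷ []))
    ≡⟨ cong length (concatMap-++ row xs (z ∷ [])) ⟩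
  length (concatMap row xs ++ row z ++ [])
    ≡⟨ cong (λ r → length (concatMap row xs ++ r ++ [])) (pairsFrom-none {P = P} (xs ++ z ∷ []) above) ⟩
  length (concatMap row xs ++ [])
    ≡⟨ cong length (++-identityʳ (concatMap row xs)) ⟩
  length (concatMap row xs)
    ≡⟨ length-concatMap-suc row (pairsFrom P xs) xs longer ⟩
  length (concatMap (pairsFrom P xs) xs) ℕ.+ length xs ∎
  where
  open ≡-Reasoning
  row : _ → List _
  row = pairsFrom P (xs ++ z ∷ [])
  longer : ∀ {p} → p ∈ xs → length (row p) ≡ suc (length (pairsFrom P xs p))
  longer {p} p∈ rewrite concatMap-++ (λ q → if P p q then (p , q) ∷ [] else []) xs (z ∷ []) | below p∈
    = trans (length-++ (pairsFrom P xs p)) (ℕP.+-comm (length (pairsFrom P xs p)) 1)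

-- Triangles through an edge

isTriangle : (ℕ → ℕ → Bool) → ℕ → ℕ → ℕ → Bool
isTriangle E p q r = (p <ᵇ q) ∧ (q <ᵇ r) ∧ E p q ∧ E q r ∧ E p r

triangle-sides : ∀ {E p q r} → isTriangle E p q r ≡ true →
                 p < q × q < r × E p q ≡ true × E q r ≡ true × E p r ≡ true
triangle-sides T≡true with ∧-true⁻ T≡true
... | p<q , rest with ∧-true⁻ rest
... | q<r , rest′ with ∧-true⁻ rest′
... | Epq , rest″ with ∧-true⁻ rest″
... | Eqr , Epr = <ᵇ-true⁻ p<q , <ᵇ-true⁻ q<r , Epq , Eqr , Epr

module _ (E : ℕ → ℕ → Bool) (E-sym : ∀ p q → E p q ≡ E q p) (E-irrefl : ∀ p → E p p ≡ false) where

  triangles-through-edge : ∀ {u v} r t → u < v → E u v ≡ true →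
    when (isTriangle E u v r) t + when (isTriangle E r u v) t + when (isTriangle E u r v) t
      ≡ when (E u r ∧ E v r) t
  triangles-through-edge {u} {v} r t u<v Euv with ℕP.<-cmp r u
  ... | tri< r<u _ _
    rewrite <ᵇ-true r<u | <ᵇ-true u<v | <ᵇ-false (ℕP.<⇒≤ (ℕP.<-trans r<u u<v)) | <ᵇ-false (ℕP.<⇒≤ r<u)
          | Euv | E-sym r u | E-sym r v
    = trans (ℚP.+-identityʳ _) (ℚP.+-identityˡ _)
  ... | tri≈ _ refl _
    rewrite <ᵇ-true u<v | <ᵇ-false (ℕP.≤-refl {r}) | <ᵇ-false (ℕP.<⇒≤ u<v) | E-irrefl r = refl
  ... | tri> _ _ u<r with ℕP.<-cmp r v
  ...   | tri< r<v _ _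
    rewrite <ᵇ-true u<r | <ᵇ-true r<v | <ᵇ-true u<v | <ᵇ-false (ℕP.<⇒≤ r<v) | <ᵇ-false (ℕP.<⇒≤ u<r)
          | Euv | E-sym r v | ∧-identityʳ (E v r)
    = ℚP.+-identityˡ _
  ...   | tri≈ _ refl _
    rewrite <ᵇ-true u<v | <ᵇ-false (ℕP.≤-refl {r}) | <ᵇ-false (ℕP.<⇒≤ u<v) | E-irrefl r | ∧-zeroʳ (E u r) = refl
  ...   | tri> _ _ v<r
    rewrite <ᵇ-true u<v | <ᵇ-true v<r | <ᵇ-true (ℕP.<-trans u<v v<r)
          | <ᵇ-false (ℕP.<⇒≤ v<r) | <ᵇ-false (ℕP.<⇒≤ (ℕP.<-trans u<v v<r))
          | Euv | ∧-comm (E v r) (E u r)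
    = trans (ℚP.+-identityʳ _) (ℚP.+-identityʳ _)

incid-sides : ∀ {p q r} → p < q → q < r → ∀ f →
              incid (p , q , r) f ≡ 𝟙 (eqE f (p , q)) + 𝟙 (eqE f (q , r)) - 𝟙 (eqE f (p , r))
incid-sides {p} {q} {r} p<q q<r (s , t)
  with eqE (s , t) (p , q) in e₁ | eqE (s , t) (q , r) in e₂ | eqE (s , t) (p , r) in e₃
... | true  | true  | _     =
  contradiction (trans (sym (proj₁ (eqE-true⁻ {s} {t} e₁))) (proj₁ (eqE-true⁻ {s} {t} e₂))) (ℕP.<⇒≢ p<q)
... | true  | false | true  =
  contradiction (trans (sym (proj₂ (eqE-true⁻ {s} {t} e₁))) (proj₂ (eqE-true⁻ {s} {t} e₃))) (ℕP.<⇒≢ q<r)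
... | false | true  | true  =
  contradiction (trans (sym (proj₁ (eqE-true⁻ {s} {t} e₃))) (proj₁ (eqE-true⁻ {s} {t} e₂))) (ℕP.<⇒≢ p<q)
... | true  | false | false = refl
... | false | true  | false = refl
... | false | false | true  = refl
... | false | false | false = refl

incid-on-triangle : ∀ E p q r f x →
  when (isTriangle E p q r) (incid (p , q , r) f * x)
    ≡ when (eqE f (p , q)) (when (isTriangle E p q r) x) + when (eqE f (q , r)) (when (isTriangle E p q r) x)
      - when (eqE f (p , r)) (when (isTriangle E p q r) x)
incid-on-triangle E p q r f x with isTriangle E p q r in T≡true
... | true with triangle-sides {E} T≡true
...   | p<q , q<r , _ =
  trans (cong (_* x) (incid-sides p<q q<r f)) (𝟙-combination (eqE f (p , q)) (eqE f (q , r)) (eqE f (p , r)) x)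
incid-on-triangle E p q r f x | false
  rewrite when-0 (eqE f (p , q)) | when-0 (eqE f (q , r)) | when-0 (eqE f (p , r)) = refl

-- The up-Laplacian of G_{c,b} on an edge

vertices : ℕ → ℕ → List ℕ
vertices c b = range 1 (b ℕ.+ c)

module _ {c b : ℕ} where

  isEdge-sym : ∀ p q → isEdge c b p q ≡ isEdge c b q p
  isEdge-sym p q = ∨-comm (adj c b p q) (adj c b q p)

  isEdge-irrefl : ∀ p → isEdge c b p p ≡ false
  isEdge-irrefl p rewrite <ᵇ-false (ℕP.≤-refl {p}) | <ᵇ-not-≤ᵇ c p
    with 0 <ᵇ p | p ≤ᵇ c | p ≤ᵇ c ℕ.+ b
  ... | true  | true  | _     = refl
  ... | false | true  | _     = refl
  ... | true  | false | true  = refl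
  ... | true  | false | false = refl
  ... | false | false | true  = refl
  ... | false | false | false = refl

  private
    isEdge-ordered : ∀ {p q} → p ∈ vertices c b → q ∈ vertices c b → p < q →
                     isEdge c b p q ≡ ((p ≤ᵇ c) ∨ (q ≤ᵇ c))
    isEdge-ordered {p} {q} p∈ q∈ p<q with ∈-range⁻ p∈ | ∈-range⁻ q∈
    ... | 1≤p , p≤n | 1≤q , q≤n
      rewrite <ᵇ-true p<q | <ᵇ-false (ℕP.<⇒≤ p<q) | <ᵇ-not-≤ᵇ c p | <ᵇ-not-≤ᵇ c q
            | <ᵇ-true 1≤p | <ᵇ-true 1≤q
            | ≤ᵇ-true (subst (p ≤_) (ℕP.+-comm b c) p≤n) | ≤ᵇ-true (subst (q ≤_) (ℕP.+-comm b c) q≤n)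
      with p ≤ᵇ c | q ≤ᵇ c
    ... | true  | true  = refl
    ... | true  | false = refl
    ... | false | true  = refl
    ... | false | false = refl

  isEdge-vertices : ∀ {p q} → p ∈ vertices c b → q ∈ vertices c b → p ≢ q →
                    isEdge c b p q ≡ ((p ≤ᵇ c) ∨ (q ≤ᵇ c))
  isEdge-vertices {p} {q} p∈ q∈ p≢q with ℕP.<-cmp p q
  ... | tri< p<q _ _ = isEdge-ordered p∈ q∈ p<q
  ... | tri≈ _ p≡q _ = contradiction p≡q p≢q
  ... | tri> _ _ q<p = trans (isEdge-sym p q) (trans (isEdge-ordered q∈ p∈ q<p) (∨-comm (q ≤ᵇ c) (p ≤ᵇ c)))

  private
    ∈-edges⁻ : ∀ {p q} → (p , q) ∈ edges c b →
               p ∈ vertices c b × q ∈ vertices c b × ((p <ᵇ q) ∧ isEdge c b p q) ≡ true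
    ∈-edges⁻ = ∈-pairsWith⁻ {P = λ p q → (p <ᵇ q) ∧ isEdge c b p q}

  edge-endpoints : ∀ {p q} → (p , q) ∈ edges c b → p ∈ vertices c b × q ∈ vertices c b
  edge-endpoints pq∈ = let p∈ , q∈ , _ = ∈-edges⁻ pq∈ in p∈ , q∈

  edge-ordered : ∀ {p q} → (p , q) ∈ edges c b → p < q
  edge-ordered pq∈ = <ᵇ-true⁻ (proj₁ (∧-true⁻ (proj₂ (proj₂ (∈-edges⁻ pq∈)))))

  edge-adjacent : ∀ {p q} → (p , q) ∈ edges c b → isEdge c b p q ≡ true
  edge-adjacent pq∈ = proj₂ (∧-true⁻ (proj₂ (proj₂ (∈-edges⁻ pq∈))))

  ∈-edges⁺ : ∀ {p q} → p ∈ vertices c b → q ∈ vertices c b → p < q → isEdge c b p q ≡ true →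
             (p , q) ∈ edges c b
  ∈-edges⁺ {p} {q} p∈ q∈ p<q Epq =
    ∈-pairsWith⁺ {P = λ p q → (p <ᵇ q) ∧ isEdge c b p q} p∈ q∈
                 (trans (cong (_∧ isEdge c b p q) (<ᵇ-true p<q)) Epq)

  clique-edge : ∀ {x y} → 1 ≤ x → x < y → y ≤ c → (x , y) ∈ edges c b
  clique-edge {x} {y} 1≤x x<y y≤c =
    ∈-edges⁺ x∈ y∈ x<y (trans (isEdge-vertices x∈ y∈ (ℕP.<⇒≢ x<y)) (cong (_∨ (y ≤ᵇ c)) (≤ᵇ-true x≤c)))
    where
    x≤c : x ≤ c
    x≤c = ℕP.<⇒≤ (ℕP.<-≤-trans x<y y≤c)
    x∈ : x ∈ vertices c b
    x∈ = ∈-range⁺ 1≤x (ℕP.≤-trans x≤c (ℕP.m≤n+m c b))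
    y∈ : y ∈ vertices c b
    y∈ = ∈-range⁺ (ℕP.≤-trans 1≤x (ℕP.<⇒≤ x<y)) (ℕP.≤-trans y≤c (ℕP.m≤n+m c b))

  edge-lower-end : ∀ {u v} → (u , v) ∈ edges c b → u ≤ c
  edge-lower-end {u} {v} uv∈ =
    let u∈ , v∈ = edge-endpoints uv∈
    in lower (trans (sym (isEdge-vertices u∈ v∈ (ℕP.<⇒≢ (edge-ordered uv∈)))) (edge-adjacent uv∈))
    where
    lower : ((u ≤ᵇ c) ∨ (v ≤ᵇ c)) ≡ true → u ≤ c
    lower eq with u ≤ᵇ c | ℕP.≤ᵇ-reflects-≤ u c | v ≤ᵇ c | ℕP.≤ᵇ-reflects-≤ v c
    ... | true  | ofʸ u≤c | _     | _       = u≤c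
    ... | false | _       | true  | ofʸ v≤c = ℕP.<⇒≤ (ℕP.<-≤-trans (edge-ordered uv∈) v≤c)
    ... | false | _       | false | _       = contradiction eq λ ()

  common-neighbours : ∀ {u v r} → (u , v) ∈ edges c b → r ∈ vertices c b → r ≢ u → r ≢ v →
                      (isEdge c b u r ∧ isEdge c b v r) ≡ ((r ≤ᵇ c) ∨ (v ≤ᵇ c))
  common-neighbours {u} {v} {r} uv∈ r∈ r≢u r≢v = let u∈ , v∈ = edge-endpoints uv∈ in begin
    isEdge c b u r ∧ isEdge c b v r
      ≡⟨ cong₂ _∧_ (isEdge-vertices u∈ r∈ (r≢u ∘ sym)) (isEdge-vertices v∈ r∈ (r≢v ∘ sym)) ⟩
    ((u ≤ᵇ c) ∨ (r ≤ᵇ c)) ∧ ((v ≤ᵇ c) ∨ (r ≤ᵇ c))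
      ≡⟨ cong (λ a → (a ∨ (r ≤ᵇ c)) ∧ ((v ≤ᵇ c) ∨ (r ≤ᵇ c))) (≤ᵇ-true (edge-lower-end uv∈)) ⟩
    (v ≤ᵇ c) ∨ (r ≤ᵇ c)
      ≡⟨ ∨-comm (v ≤ᵇ c) (r ≤ᵇ c) ⟩
    (r ≤ᵇ c) ∨ (v ≤ᵇ c) ∎
    where open ≡-Reasoning

  δ₁-on-triangle : ∀ (w : EVec) (ω : ℕ → ℕ → ℚ) →
                   (∀ {p q} → (p , q) ∈ edges c b → w (p , q) ≡ ω p q) →
                   ∀ {p q r} → p ∈ vertices c b → q ∈ vertices c b → r ∈ vertices c b →
                   isTriangle (isEdge c b) p q r ≡ true → δ₁ c b w (p , q , r) ≡ ω p q + ω q r - ω p r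
  δ₁-on-triangle w ω w≡ω {p} {q} {r} p∈ q∈ r∈ T≡true with triangle-sides {isEdge c b} T≡true
  ... | p<q , q<r , Epq , Eqr , Epr = begin
    δ₁ c b w (p , q , r)
      ≡⟨ sumℚ-map (edges c b) _ ⟩
    ∑[ g ∈ edges c b ] (incid (p , q , r) g * w g)
      ≡⟨ ∑-cong (edges c b) (λ {g} _ → split g) ⟩
    ∑[ g ∈ edges c b ] (at (p , q) g + at (q , r) g - at (p , r) g)
      ≡⟨ ∑-+- (edges c b) (at (p , q)) (at (q , r)) (at (p , r)) ⟩
    ∑ (edges c b) (at (p , q)) + ∑ (edges c b) (at (q , r)) - ∑ (edges c b) (at (p , r))
      ≡⟨ cong₂ _-_ (cong₂ _+_ (picked p∈ q∈ p<q Epq) (picked q∈ r∈ q<r Eqr))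
                   (picked p∈ r∈ (ℕP.<-trans p<q q<r) Epr) ⟩
    ω p q + ω q r - ω p r ∎
    where
    open ≡-Reasoning
    at : Edge → Edge → ℚ
    at e g = when (eqE e g) (w g)
    split : ∀ g → incid (p , q , r) g * w g ≡ at (p , q) g + at (q , r) g - at (p , r) g
    split g rewrite eqE-sym (p , q) g | eqE-sym (q , r) g | eqE-sym (p , r) g =
      trans (cong (_* w g) (incid-sides p<q q<r g)) (𝟙-combination (eqE g (p , q)) (eqE g (q , r)) (eqE g (p , r)) (w g))
    picked : ∀ {s t} → s ∈ vertices c b → t ∈ vertices c b → s < t → isEdge c b s t ≡ true →
             ∑ (edges c b) (at (s , t)) ≡ ω s t
    picked s∈ t∈ s<t Est = let st∈ = ∈-edges⁺ s∈ t∈ s<t Est in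
      trans (∑-pairsWith-pick w (range-unique 1 (b ℕ.+ c)) st∈) (w≡ω st∈)

  δ₁ᵀ-on-edge : ∀ (U : TVec) {u v} → u ∈ vertices c b → v ∈ vertices c b →
    δ₁ᵀ c b U (u , v)
      ≡ ∑[ r ∈ vertices c b ] when (isTriangle (isEdge c b) u v r) (U (u , v , r))
        + ∑[ r ∈ vertices c b ] when (isTriangle (isEdge c b) r u v) (U (r , u , v))
        - ∑[ r ∈ vertices c b ] when (isTriangle (isEdge c b) u r v) (U (u , r , v))
  δ₁ᵀ-on-edge U {u} {v} u∈ v∈ = begin
    δ₁ᵀ c b U (u , v)
      ≡⟨ sumℚ-map (triangles c b) _ ⟩
    ∑[ T ∈ triangles c b ] (incid T (u , v) * U T)
      ≡⟨ ∑-triplesWith (isTriangle (isEdge c b)) V _ ⟩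
    ∑[ p ∈ V ] ∑[ q ∈ V ] ∑[ r ∈ V ] when (isTriangle (isEdge c b) p q r) (incid (p , q , r) (u , v) * U (p , q , r))
      ≡⟨ ∑-cong V (λ {p} _ → ∑-cong V (λ {q} _ → ∑-cong V (λ {r} _ →
           incid-on-triangle (isEdge c b) p q r (u , v) (U (p , q , r))))) ⟩
    ∑[ p ∈ V ] ∑[ q ∈ V ] ∑[ r ∈ V ] (when ((u ≡ᵇ p) ∧ (v ≡ᵇ q)) (G p q r) + when ((u ≡ᵇ q) ∧ (v ≡ᵇ r)) (G p q r)
                                       - when ((u ≡ᵇ p) ∧ (v ≡ᵇ r)) (G p q r))
      ≡⟨ ∑-+-³ V (λ p q r → when ((u ≡ᵇ p) ∧ (v ≡ᵇ q)) (G p q r)) (λ p q r → when ((u ≡ᵇ q) ∧ (v ≡ᵇ r)) (G p q r))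
                 (λ p q r → when ((u ≡ᵇ p) ∧ (v ≡ᵇ r)) (G p q r)) ⟩
    ∑[ p ∈ V ] ∑[ q ∈ V ] ∑[ r ∈ V ] when ((u ≡ᵇ p) ∧ (v ≡ᵇ q)) (G p q r)
      + ∑[ p ∈ V ] ∑[ q ∈ V ] ∑[ r ∈ V ] when ((u ≡ᵇ q) ∧ (v ≡ᵇ r)) (G p q r)
      - ∑[ p ∈ V ] ∑[ q ∈ V ] ∑[ r ∈ V ] when ((u ≡ᵇ p) ∧ (v ≡ᵇ r)) (G p q r)
      ≡⟨ cong₂ _-_ (cong₂ _+_ first last) middle ⟩
    ∑[ r ∈ V ] G u v r + ∑[ p ∈ V ] G p u v - ∑[ q ∈ V ] G u q v ∎
    where
    open ≡-Reasoning
    V : List ℕ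
    V = vertices c b
    uniq : Unique V
    uniq = range-unique 1 (b ℕ.+ c)
    G : ℕ → ℕ → ℕ → ℚ
    G p q r = when (isTriangle (isEdge c b) p q r) (U (p , q , r))
    first : ∑[ p ∈ V ] ∑[ q ∈ V ] ∑[ r ∈ V ] when ((u ≡ᵇ p) ∧ (v ≡ᵇ q)) (G p q r) ≡ ∑[ r ∈ V ] G u v r
    first = trans (∑-cong V (λ {p} _ → ∑-cong V (λ {q} _ → ∑-when V ((u ≡ᵇ p) ∧ (v ≡ᵇ q)) (G p q))))
                  (∑-pick₂ (λ p q → ∑ V (G p q)) uniq u∈ v∈)
    last : ∑[ p ∈ V ] ∑[ q ∈ V ] ∑[ r ∈ V ] when ((u ≡ᵇ q) ∧ (v ≡ᵇ r)) (G p q r) ≡ ∑[ p ∈ V ] G p u v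
    last = ∑-cong V (λ {p} _ → ∑-pick₂ (G p) uniq u∈ v∈)
    middle : ∑[ p ∈ V ] ∑[ q ∈ V ] ∑[ r ∈ V ] when ((u ≡ᵇ p) ∧ (v ≡ᵇ r)) (G p q r) ≡ ∑[ q ∈ V ] G u q v
    middle = begin
      ∑[ p ∈ V ] ∑[ q ∈ V ] ∑[ r ∈ V ] when ((u ≡ᵇ p) ∧ (v ≡ᵇ r)) (G p q r)
        ≡⟨ ∑-cong V (λ {p} _ → trans (∑-cong V (λ {q} _ →
             trans (∑-cong V (λ {r} _ → when-∧ (u ≡ᵇ p) (v ≡ᵇ r) (G p q r))) (∑-when V (u ≡ᵇ p) _)))
             (∑-when V (u ≡ᵇ p) _)) ⟩
      ∑[ p ∈ V ] when (u ≡ᵇ p) (∑[ q ∈ V ] ∑[ r ∈ V ] when (v ≡ᵇ r) (G p q r))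
        ≡⟨ ∑-pick _ uniq u∈ ⟩
      ∑[ q ∈ V ] ∑[ r ∈ V ] when (v ≡ᵇ r) (G u q r)
        ≡⟨ ∑-cong V (λ {q} _ → ∑-pick (G u q) uniq v∈) ⟩
      ∑[ q ∈ V ] G u q v ∎

  triangle-contributions :
    ∀ (w : EVec) (ω : ℕ → ℕ → ℚ) → (∀ p q → ω q p ≡ - ω p q) →
    (∀ {p q} → (p , q) ∈ edges c b → w (p , q) ≡ ω p q) →
    ∀ {u v r} → (u , v) ∈ edges c b → r ∈ vertices c b →
    when (isTriangle (isEdge c b) u v r) (δ₁ c b w (u , v , r))
      + when (isTriangle (isEdge c b) r u v) (δ₁ c b w (r , u , v))
      - when (isTriangle (isEdge c b) u r v) (δ₁ c b w (u , r , v))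
      ≡ when (isEdge c b u r ∧ isEdge c b v r) (ω u v + ω v r - ω u r)
  triangle-contributions w ω antisym w≡ω {u} {v} {r} uv∈ r∈ =
    trans (cong₂ _+_ (cong₂ _+_ last first) middle)
          (triangles-through-edge (isEdge c b) isEdge-sym isEdge-irrefl r F (edge-ordered uv∈) (edge-adjacent uv∈))
    where
    open ≡-Reasoning
    u∈ : u ∈ vertices c b
    u∈ = proj₁ (edge-endpoints uv∈)
    v∈ : v ∈ vertices c b
    v∈ = proj₂ (edge-endpoints uv∈)
    T : ℕ → ℕ → ℕ → Bool
    T = isTriangle (isEdge c b)
    F : ℚ
    F = ω u v + ω v r - ω u r
    last : when (T u v r) (δ₁ c b w (u , v , r)) ≡ when (T u v r) F
    last = when-cong (T u v r) (δ₁-on-triangle w ω w≡ω u∈ v∈ r∈)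
    first : when (T r u v) (δ₁ c b w (r , u , v)) ≡ when (T r u v) F
    first = when-cong (T r u v) λ T≡true → begin
      δ₁ c b w (r , u , v)        ≡⟨ δ₁-on-triangle w ω w≡ω r∈ u∈ v∈ T≡true ⟩
      ω r u + ω u v - ω r v       ≡⟨ cong₂ (λ x y → x + ω u v - y) (antisym u r) (antisym v r) ⟩
      - ω u r + ω u v - - ω v r
        ≡⟨ solve 3 (λ a b c → :- a :+ b :- (:- c) := b :+ c :- a) refl (ω u r) (ω u v) (ω v r) ⟩
      F ∎
    middle : - when (T u r v) (δ₁ c b w (u , r , v)) ≡ when (T u r v) F
    middle = trans (sym (when-neg (T u r v) (δ₁ c b w (u , r , v)))) (when-cong (T u r v) λ T≡true → begin
      - δ₁ c b w (u , r , v)        ≡⟨ cong -_ (δ₁-on-triangle w ω w≡ω u∈ r∈ v∈ T≡true) ⟩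
      - (ω u r + ω r v - ω u v)     ≡⟨ cong (λ y → - (ω u r + y - ω u v)) (antisym v r) ⟩
      - (ω u r + - ω v r - ω u v)
        ≡⟨ solve 3 (λ a b c → :- (a :+ :- c :- b) := b :+ c :- a) refl (ω u r) (ω u v) (ω v r) ⟩
      F ∎)

  upLap-on-edge : ∀ (w : EVec) (ω : ℕ → ℕ → ℚ) → (∀ p q → ω q p ≡ - ω p q) →
                  (∀ {p q} → (p , q) ∈ edges c b → w (p , q) ≡ ω p q) →
                  ∀ {u v} → (u , v) ∈ edges c b →
                  upLap c b w (u , v)
                    ≡ ∑[ r ∈ vertices c b ] when (isEdge c b u r ∧ isEdge c b v r) (ω u v + ω v r - ω u r)
  upLap-on-edge w ω antisym w≡ω {u} {v} uv∈ = begin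
    upLap c b w (u , v)
      ≡⟨ δ₁ᵀ-on-edge (δ₁ c b w) (proj₁ (edge-endpoints uv∈)) (proj₂ (edge-endpoints uv∈)) ⟩
    ∑[ r ∈ V ] when (T u v r) (δw u v r) + ∑[ r ∈ V ] when (T r u v) (δw r u v)
      - ∑[ r ∈ V ] when (T u r v) (δw u r v)
      ≡⟨ sym (∑-+- V (λ r → when (T u v r) (δw u v r)) (λ r → when (T r u v) (δw r u v))
                     (λ r → when (T u r v) (δw u r v))) ⟩
    ∑[ r ∈ V ] (when (T u v r) (δw u v r) + when (T r u v) (δw r u v) - when (T u r v) (δw u r v))
      ≡⟨ ∑-cong V (triangle-contributions w ω antisym w≡ω uv∈) ⟩
    ∑[ r ∈ V ] when (isEdge c b u r ∧ isEdge c b v r) (ω u v + ω v r - ω u r) ∎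
    where
    open ≡-Reasoning
    V : List ℕ
    V = vertices c b
    T : ℕ → ℕ → ℕ → Bool
    T = isTriangle (isEdge c b)
    δw : ℕ → ℕ → ℕ → ℚ
    δw p q r = δ₁ c b w (p , q , r)

  upLap-on-edge-split : ∀ (w : EVec) (ω : ℕ → ℕ → ℚ) →
                        (∀ p q → ω q p ≡ - ω p q) → (∀ p → ω p p ≡ 0ℚ) →
                        (∀ {p q} → (p , q) ∈ edges c b → w (p , q) ≡ ω p q) →
                        ∀ {u v} → (u , v) ∈ edges c b →
                        upLap c b w (u , v)
                          ≡ ∑[ r ∈ range 1 c ] (ω u v + ω v r - ω u r)
                            + when (v ≤ᵇ c) (∑[ r ∈ range (suc c) (b ℕ.+ c) ] (ω u v + ω v r - ω u r))
  upLap-on-edge-split w ω antisym diag w≡ω {u} {v} uv∈ = begin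
    upLap c b w (u , v)
      ≡⟨ upLap-on-edge w ω antisym w≡ω uv∈ ⟩
    ∑[ r ∈ vertices c b ] when (isEdge c b u r ∧ isEdge c b v r) (F r)
      ≡⟨ ∑-cong (vertices c b) guard ⟩
    ∑[ r ∈ vertices c b ] when ((r ≤ᵇ c) ∨ (v ≤ᵇ c)) (F r)
      ≡⟨ cong (λ xs → ∑[ r ∈ xs ] when ((r ≤ᵇ c) ∨ (v ≤ᵇ c)) (F r)) (range-split c b) ⟩
    ∑[ r ∈ range 1 c ++ range (suc c) (b ℕ.+ c) ] when ((r ≤ᵇ c) ∨ (v ≤ᵇ c)) (F r)
      ≡⟨ ∑-++ (range 1 c) _ _ ⟩
    ∑[ r ∈ range 1 c ] when ((r ≤ᵇ c) ∨ (v ≤ᵇ c)) (F r)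
      + ∑[ r ∈ range (suc c) (b ℕ.+ c) ] when ((r ≤ᵇ c) ∨ (v ≤ᵇ c)) (F r)
      ≡⟨ cong₂ _+_ (∑-cong (range 1 c) (λ r∈ → cong (λ a → when (a ∨ (v ≤ᵇ c)) _)
                                             (≤ᵇ-true (proj₂ (∈-range⁻ r∈)))))
                   (trans (∑-cong (range (suc c) (b ℕ.+ c)) (λ r∈ → cong (λ a → when (a ∨ (v ≤ᵇ c)) _)
                                   (≤ᵇ-false (proj₁ (∈-range⁻ r∈)))))
                          (∑-when (range (suc c) (b ℕ.+ c)) (v ≤ᵇ c) F)) ⟩
    ∑[ r ∈ range 1 c ] F r + when (v ≤ᵇ c) (∑[ r ∈ range (suc c) (b ℕ.+ c) ] F r) ∎
    where
    open ≡-Reasoning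
    F : ℕ → ℚ
    F r = ω u v + ω v r - ω u r
    F-u : F u ≡ 0ℚ
    F-u rewrite antisym u v | diag u = trans (ℚP.+-identityʳ _) (ℚP.+-inverseʳ (ω u v))
    F-v : F v ≡ 0ℚ
    F-v rewrite diag v | ℚP.+-identityʳ (ω u v) = ℚP.+-inverseʳ (ω u v)
    -- F vanishes at u and at v, so whether they count as common neighbours is immaterial.
    guard : ∀ {r} → r ∈ vertices c b →
            when (isEdge c b u r ∧ isEdge c b v r) (F r) ≡ when ((r ≤ᵇ c) ∨ (v ≤ᵇ c)) (F r)
    guard {r} r∈ with r ℕ.≟ u | r ℕ.≟ v
    ... | yes refl | _ rewrite isEdge-irrefl r | F-u = sym (when-0 _)
    ... | no _ | yes refl rewrite isEdge-irrefl r | ∧-zeroʳ (isEdge c b u r) | F-v = sym (when-0 _)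
    ... | no r≢u | no r≢v = cong (λ a → when a (F r)) (common-neighbours uv∈ r∈ r≢u r≢v)

-- Alternating functions of vertex pairs

wedge : (ℕ → ℚ) → (ℕ → ℚ) → ℕ → ℕ → ℚ
wedge α β s t = α s * β t - α t * β s

wedge-antisym : ∀ α β s t → wedge α β t s ≡ - wedge α β s t
wedge-antisym α β s t =
  solve 4 (λ a b c d → c :* b :- a :* d := :- (a :* d :- c :* b)) refl (α s) (β s) (α t) (β t)

wedge-diag : ∀ α β s → wedge α β s s ≡ 0ℚ
wedge-diag α β s = ℚP.+-inverseʳ (α s * β s)

∑-wedge : ∀ (xs : List ℕ) α β a → ∑[ r ∈ xs ] wedge α β a r ≡ α a * ∑ xs β - ∑ xs α * β a
∑-wedge xs α β a =
  trans (∑-- xs (λ r → α a * β r) (λ r → α r * β a)) (cong₂ _-_ (∑-*ˡ xs (α a) β) (∑-*ʳ xs (β a) α))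

-- The eigenvectors w_{x,y}

module _ (c b′ x y : ℕ) where

  private
    b : ℕ
    b = suc b′
    K I : List ℕ
    K = range 1 c
    I = range (suc c) (b ℕ.+ c)
    c≤n : c ≤ b ℕ.+ c
    c≤n = ℕP.m≤n+m c b

  δ : ℕ → ℕ → ℚ
  δ z r = 𝟙 (r ≡ᵇ z)

  ξ : ℕ → ℚ
  ξ r = δ y r - δ x r

  ι : ℕ → ℚ
  ι r = 𝟙 (c <ᵇ r)

  ω : ℕ → ℕ → ℚ
  ω s t = wedge (δ x) (δ y) s t + invℕ b * wedge ξ ι s t

  wvec-value : ∀ s {t} → t ≤ b ℕ.+ c → wvec c b x y (s , t) ≡ 𝟙 ((s ≡ᵇ x) ∧ (t ≡ᵇ y)) + invℕ b * (ξ s * ι t)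
  wvec-value s {t} t≤n = cong (λ z → 𝟙 ((s ≡ᵇ x) ∧ (t ≡ᵇ y)) + invℕ b * z) (begin
    sumᵥ (map column I) (s , t)
      ≡⟨ sumᵥ-map column I (s , t) ⟩
    ∑[ i ∈ I ] column i (s , t)
      ≡⟨ ∑-cong I (λ {i} _ → entry i) ⟩
    ∑[ i ∈ I ] (ξ s * 𝟙 (t ≡ᵇ i))
      ≡⟨ ∑-*ˡ I (ξ s) _ ⟩
    ξ s * ∑[ i ∈ I ] 𝟙 (t ≡ᵇ i)
      ≡⟨ cong (ξ s *_) (∑-𝟙-range t≤n) ⟩
    ξ s * ι t ∎)
    where
    open ≡-Reasoning
    column : ℕ → EVec
    column i = ((- 1ℚ) ·ᵥ basis (x , i)) +ᵥ basis (y , i)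
    entry : ∀ i → column i (s , t) ≡ ξ s * 𝟙 (t ≡ᵇ i)
    entry i rewrite 𝟙-∧ (s ≡ᵇ x) (t ≡ᵇ i) | 𝟙-∧ (s ≡ᵇ y) (t ≡ᵇ i) =
      solve 3 (λ X Y T → con (- 1ℚ) :* (X :* T) :+ Y :* T := (Y :- X) :* T) refl (δ x s) (δ y s) (𝟙 (t ≡ᵇ i))

  wvec-on-clique : ∀ s {t} → t ≤ c → wvec c b x y (s , t) ≡ 𝟙 ((s ≡ᵇ x) ∧ (t ≡ᵇ y))
  wvec-on-clique s {t} t≤c = begin
    wvec c b x y (s , t)
      ≡⟨ wvec-value s (ℕP.≤-trans t≤c c≤n) ⟩
    𝟙 ((s ≡ᵇ x) ∧ (t ≡ᵇ y)) + invℕ b * (ξ s * ι t)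
      ≡⟨ cong (λ q → 𝟙 ((s ≡ᵇ x) ∧ (t ≡ᵇ y)) + invℕ b * (ξ s * 𝟙 q)) (<ᵇ-false t≤c) ⟩
    𝟙 ((s ≡ᵇ x) ∧ (t ≡ᵇ y)) + invℕ b * (ξ s * 0ℚ)
      ≡⟨ solve 3 (λ E i Z → E :+ i :* (Z :* con 0ℚ) := E) refl (𝟙 ((s ≡ᵇ x) ∧ (t ≡ᵇ y))) (invℕ b) (ξ s) ⟩
    𝟙 ((s ≡ᵇ x) ∧ (t ≡ᵇ y)) ∎
    where open ≡-Reasoning

  ∑-ω : ∀ xs a → ∑[ r ∈ xs ] ω a r
               ≡ (δ x a * ∑ xs (δ y) - ∑ xs (δ x) * δ y a)
                 + invℕ b * (ξ a * ∑ xs ι - (∑ xs (δ y) - ∑ xs (δ x)) * ι a)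
  ∑-ω xs a = begin
    ∑[ r ∈ xs ] ω a r
      ≡⟨ ∑-+ xs (wedge (δ x) (δ y) a) (λ r → invℕ b * wedge ξ ι a r) ⟩
    ∑ xs (wedge (δ x) (δ y) a) + ∑[ r ∈ xs ] (invℕ b * wedge ξ ι a r)
      ≡⟨ cong₂ _+_ (∑-wedge xs (δ x) (δ y) a)
                   (trans (∑-*ˡ xs (invℕ b) (wedge ξ ι a)) (cong (invℕ b *_) (∑-wedge xs ξ ι a))) ⟩
    (δ x a * ∑ xs (δ y) - ∑ xs (δ x) * δ y a) + invℕ b * (ξ a * ∑ xs ι - ∑ xs ξ * ι a)
      ≡⟨ cong (λ z → (δ x a * ∑ xs (δ y) - ∑ xs (δ x) * δ y a) + invℕ b * (ξ a * ∑ xs ι - z * ι a))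
              (∑-- xs (δ y) (δ x)) ⟩
    (δ x a * ∑ xs (δ y) - ∑ xs (δ x) * δ y a) + invℕ b * (ξ a * ∑ xs ι - (∑ xs (δ y) - ∑ xs (δ x)) * ι a) ∎
    where open ≡-Reasoning

  length-I : length I ≡ b
  length-I = trans (length-range (suc c) (b ℕ.+ c)) (ℕP.m+n∸n≡m b c)

  ∑-ι-clique : ∑ K ι ≡ 0ℚ
  ∑-ι-clique = trans (∑-cong K (λ r∈ → cong 𝟙 (<ᵇ-false (proj₂ (∈-range⁻ r∈))))) (∑-zero K)

  ∑-ι-independent : ∑ I ι ≡ fromℕ b
  ∑-ι-independent = begin
    ∑ I ι                                ≡⟨ ∑-cong I (λ r∈ → cong 𝟙 (<ᵇ-true (proj₁ (∈-range⁻ r∈)))) ⟩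
    ∑[ r ∈ I ] 1ℚ                        ≡⟨ ∑-const I 1ℚ ⟩
    fromℕ (length I) * 1ℚ                ≡⟨ ℚP.*-identityʳ _ ⟩
    fromℕ (length I)                     ≡⟨ cong fromℕ length-I ⟩
    fromℕ b ∎
    where open ≡-Reasoning

  ∑-δ-clique : ∀ {z} → 1 ≤ z → z ≤ c → ∑[ r ∈ K ] δ z r ≡ 1ℚ
  ∑-δ-clique {z} 1≤z z≤c =
    trans (∑-cong K (λ {r} _ → cong 𝟙 (≡ᵇ-sym r z))) (trans (∑-𝟙-range z≤c) (cong 𝟙 (≤ᵇ-true 1≤z)))

  ∑-δ-independent : ∀ {z} → z ≤ c → ∑[ r ∈ I ] δ z r ≡ 0ℚ
  ∑-δ-independent {z} z≤c =
    trans (∑-cong I (λ {r} _ → cong 𝟙 (≡ᵇ-sym r z)))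
          (trans (∑-𝟙-range (ℕP.≤-trans z≤c c≤n)) (cong 𝟙 (<ᵇ-false z≤c)))

  ω-antisym : ∀ p q → ω q p ≡ - ω p q
  ω-antisym p q = begin
    ω q p
      ≡⟨ cong₂ (λ s t → s + invℕ b * t) (wedge-antisym (δ x) (δ y) p q) (wedge-antisym ξ ι p q) ⟩
    - wedge (δ x) (δ y) p q + invℕ b * - wedge ξ ι p q
      ≡⟨ solve 3 (λ A i B → :- A :+ i :* :- B := :- (A :+ i :* B)) refl (wedge (δ x) (δ y) p q) (invℕ b) (wedge ξ ι p q) ⟩
    - ω p q ∎
    where open ≡-Reasoning

  ω-diag : ∀ p → ω p p ≡ 0ℚ
  ω-diag p rewrite wedge-diag (δ x) (δ y) p | wedge-diag ξ ι p = trans (ℚP.+-identityˡ _) (ℚP.*-zeroʳ (invℕ b))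

  module _ (1≤x : 1 ≤ x) (x<y : x < y) (y≤c : y ≤ c) where

    private
      x≤c : x ≤ c
      x≤c = ℕP.<⇒≤ (ℕP.<-≤-trans x<y y≤c)

    divergence-clique : ∀ a → ∑[ r ∈ K ] ω a r ≡ - ξ a
    divergence-clique a = begin
      ∑[ r ∈ K ] ω a r
        ≡⟨ ∑-ω K a ⟩
      (δ x a * ∑ K (δ y) - ∑ K (δ x) * δ y a) + invℕ b * (ξ a * ∑ K ι - (∑ K (δ y) - ∑ K (δ x)) * ι a)
        ≡⟨ cong₂ (λ X Y → (δ x a * Y - X * δ y a) + invℕ b * (ξ a * ∑ K ι - (Y - X) * ι a))
                 (∑-δ-clique 1≤x x≤c) (∑-δ-clique (ℕP.≤-trans 1≤x (ℕP.<⇒≤ x<y)) y≤c) ⟩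
      (δ x a * 1ℚ - 1ℚ * δ y a) + invℕ b * (ξ a * ∑ K ι - (1ℚ - 1ℚ) * ι a)
        ≡⟨ cong (λ J → (δ x a * 1ℚ - 1ℚ * δ y a) + invℕ b * (ξ a * J - (1ℚ - 1ℚ) * ι a)) ∑-ι-clique ⟩
      (δ x a * 1ℚ - 1ℚ * δ y a) + invℕ b * (ξ a * 0ℚ - (1ℚ - 1ℚ) * ι a)
        ≡⟨ solve 4 (λ X Y i J → (X :* con 1ℚ :- con 1ℚ :* Y) :+ i :* ((Y :- X) :* con 0ℚ :- (con 1ℚ :- con 1ℚ) :* J)
                                := :- (Y :- X))
                 refl (δ x a) (δ y a) (invℕ b) (ι a) ⟩
      - ξ a ∎
      where open ≡-Reasoning

    divergence-independent : ∀ a → ∑[ r ∈ I ] ω a r ≡ ξ a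
    divergence-independent a = begin
      ∑[ r ∈ I ] ω a r
        ≡⟨ ∑-ω I a ⟩
      (δ x a * ∑ I (δ y) - ∑ I (δ x) * δ y a) + invℕ b * (ξ a * ∑ I ι - (∑ I (δ y) - ∑ I (δ x)) * ι a)
        ≡⟨ cong₂ (λ X Y → (δ x a * Y - X * δ y a) + invℕ b * (ξ a * ∑ I ι - (Y - X) * ι a))
                 (∑-δ-independent x≤c) (∑-δ-independent y≤c) ⟩
      (δ x a * 0ℚ - 0ℚ * δ y a) + invℕ b * (ξ a * ∑ I ι - (0ℚ - 0ℚ) * ι a)
        ≡⟨ cong (λ J → (δ x a * 0ℚ - 0ℚ * δ y a) + invℕ b * (ξ a * J - (0ℚ - 0ℚ) * ι a)) ∑-ι-independent ⟩
      (δ x a * 0ℚ - 0ℚ * δ y a) + invℕ b * (ξ a * fromℕ b - (0ℚ - 0ℚ) * ι a)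
        ≡⟨ solve 5 (λ X Y i B J → (X :* con 0ℚ :- con 0ℚ :* Y) :+ i :* ((Y :- X) :* B :- (con 0ℚ :- con 0ℚ) :* J)
                                  := (B :* i) :* (Y :- X))
                 refl (δ x a) (δ y a) (invℕ b) (fromℕ b) (ι a) ⟩
      (fromℕ b * invℕ b) * ξ a
        ≡⟨ cong (_* ξ a) (fromℕ-*-invℕ b′) ⟩
      1ℚ * ξ a
        ≡⟨ ℚP.*-identityˡ _ ⟩
      ξ a ∎
      where open ≡-Reasoning

    crossing : ∀ {s t} → s < t → δ x t * δ y s ≡ 0ℚ
    crossing {s} {t} s<t with t ≡ᵇ x | ≡ᵇ-reflects t x | s ≡ᵇ y | ≡ᵇ-reflects s y
    ... | true  | ofʸ refl | true  | ofʸ refl = contradiction (ℕP.<-trans s<t x<y) (ℕP.<-irrefl refl)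
    ... | true  | _        | false | _        = refl
    ... | false | _        | w     | _        = ℚP.*-zeroˡ (𝟙 w)

    wvec-on-edge : ∀ {s t} → (s , t) ∈ edges c b → wvec c b x y (s , t) ≡ ω s t
    wvec-on-edge {s} {t} st∈ = sym (begin
      ω s t
        ≡⟨ cong₂ (λ p q → (δ x s * δ y t - p) + invℕ b * (ξ s * ι t - ξ t * q))
                 (crossing (edge-ordered {c} {b} st∈)) ι-s ⟩
      (δ x s * δ y t - 0ℚ) + invℕ b * (ξ s * ι t - ξ t * 0ℚ)
        ≡⟨ solve 6 (λ X Y i Z Z′ J → (X :* Y :- con 0ℚ) :+ i :* (Z :* J :- Z′ :* con 0ℚ) := X :* Y :+ i :* (Z :* J))
                 refl (δ x s) (δ y t) (invℕ b) (ξ s) (ξ t) (ι t) ⟩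
      δ x s * δ y t + invℕ b * (ξ s * ι t)
        ≡⟨ cong (_+ invℕ b * (ξ s * ι t)) (sym (𝟙-∧ (s ≡ᵇ x) (t ≡ᵇ y))) ⟩
      𝟙 ((s ≡ᵇ x) ∧ (t ≡ᵇ y)) + invℕ b * (ξ s * ι t)
        ≡⟨ sym (wvec-value s (proj₂ (∈-range⁻ {1} {b ℕ.+ c} (proj₂ (edge-endpoints {c} {b} st∈))))) ⟩
      wvec c b x y (s , t) ∎)
      where
      open ≡-Reasoning
      ι-s : ι s ≡ 0ℚ
      ι-s = cong 𝟙 (<ᵇ-false (edge-lower-end {c} {b} st∈))

    wvec-at-own-edge : wvec c b x y (x , y) ≡ 1ℚ
    wvec-at-own-edge = trans (wvec-on-clique x y≤c) (cong 𝟙 (cong₂ _∧_ (≡ᵇ-refl x) (≡ᵇ-refl y)))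

    ξ-independent : ∀ {v} → c < v → ξ v ≡ 0ℚ
    ξ-independent {v} c<v
      rewrite ≡ᵇ-false (ℕP.>⇒≢ (ℕP.≤-<-trans y≤c c<v)) | ≡ᵇ-false (ℕP.>⇒≢ (ℕP.≤-<-trans x≤c c<v)) = refl

    ω-mixed-edge : ∀ {u v} → u ≤ c → c < v → fromℕ b * ω u v ≡ ξ u
    ω-mixed-edge {u} {v} u≤c c<v = begin
      fromℕ b * ω u v
        ≡⟨ cong (fromℕ b *_) (cong₂ (λ p q → p + invℕ b * q) clique-part independent-part) ⟩
      fromℕ b * (0ℚ + invℕ b * ξ u)
        ≡⟨ solve 3 (λ B i Z → B :* (con 0ℚ :+ i :* Z) := (B :* i) :* Z) refl (fromℕ b) (invℕ b) (ξ u) ⟩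
      (fromℕ b * invℕ b) * ξ u
        ≡⟨ cong (_* ξ u) (fromℕ-*-invℕ b′) ⟩
      1ℚ * ξ u
        ≡⟨ ℚP.*-identityˡ (ξ u) ⟩
      ξ u ∎
      where
      open ≡-Reasoning
      clique-part : wedge (δ x) (δ y) u v ≡ 0ℚ
      clique-part
        rewrite ≡ᵇ-false (ℕP.>⇒≢ (ℕP.≤-<-trans y≤c c<v)) | ≡ᵇ-false (ℕP.>⇒≢ (ℕP.≤-<-trans x≤c c<v)) =
        solve 2 (λ X Y → X :* con 0ℚ :- con 0ℚ :* Y := con 0ℚ) refl (δ x u) (δ y u)
      independent-part : wedge ξ ι u v ≡ ξ u
      independent-part rewrite ξ-independent c<v | <ᵇ-true c<v | <ᵇ-false u≤c =
        solve 1 (λ Z → Z :* con 1ℚ :- con 0ℚ :* con 0ℚ := Z) refl (ξ u)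

    eigen-on-edge : ∀ {u v} → (u , v) ∈ edges c b →
                    upLap c b (wvec c b x y) (u , v) ≡ fromℕ (b ℕ.+ c) * wvec c b x y (u , v)
    eigen-on-edge {u} {v} uv∈ = begin
      upLap c b (wvec c b x y) (u , v)
        ≡⟨ upLap-on-edge-split {c} {b} (wvec c b x y) ω ω-antisym ω-diag wvec-on-edge uv∈ ⟩
      ∑[ r ∈ K ] F r + when (v ≤ᵇ c) (∑[ r ∈ I ] F r)
        ≡⟨ cong₂ (λ p q → p + when (v ≤ᵇ c) q)
                 (trans (∑-F K (divergence-clique v) (divergence-clique u))
                        (cong (λ n → fromℕ n * ω u v + - ξ v - - ξ u) (length-range 1 c)))
                 (trans (∑-F I (divergence-independent v) (divergence-independent u))
                        (cong (λ n → fromℕ n * ω u v + ξ v - ξ u) length-I)) ⟩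
      (fromℕ c * ω u v + - ξ v - - ξ u) + when (v ≤ᵇ c) (fromℕ b * ω u v + ξ v - ξ u)
        ≡⟨ collect ⟩
      (fromℕ b + fromℕ c) * ω u v
        ≡⟨ cong₂ _*_ (sym (fromℕ-+ b c)) (sym (wvec-on-edge uv∈)) ⟩
      fromℕ (b ℕ.+ c) * wvec c b x y (u , v) ∎
      where
      open ≡-Reasoning
      F : ℕ → ℚ
      F r = ω u v + ω v r - ω u r
      ∑-F : ∀ xs {Dv Du} → ∑ xs (ω v) ≡ Dv → ∑ xs (ω u) ≡ Du → ∑ xs F ≡ fromℕ (length xs) * ω u v + Dv - Du
      ∑-F xs Dv≡ Du≡ = trans (∑-+- xs (λ _ → ω u v) (ω v) (ω u))
                             (cong₂ _-_ (cong₂ _+_ (∑-const xs (ω u v)) Dv≡) Du≡)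
      collect : (fromℕ c * ω u v + - ξ v - - ξ u) + when (v ≤ᵇ c) (fromℕ b * ω u v + ξ v - ξ u)
                  ≡ (fromℕ b + fromℕ c) * ω u v
      collect with v ≤ᵇ c | ℕP.≤ᵇ-reflects-≤ v c
      ... | true | _ =
        solve 5 (λ K B o p q → (K :* o :+ :- p :- :- q) :+ (B :* o :+ p :- q) := (B :+ K) :* o)
              refl (fromℕ c) (fromℕ b) (ω u v) (ξ v) (ξ u)
      ... | false | ofⁿ v≰c = begin
        (fromℕ c * ω u v + - ξ v - - ξ u) + 0ℚ
          ≡⟨ cong₂ (λ p q → (fromℕ c * ω u v + - p - - q) + 0ℚ)
                   (ξ-independent (ℕP.≰⇒> v≰c)) (sym (ω-mixed-edge (edge-lower-end {c} {b} uv∈) (ℕP.≰⇒> v≰c))) ⟩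
        (fromℕ c * ω u v + - 0ℚ - - (fromℕ b * ω u v)) + 0ℚ
          ≡⟨ solve 3 (λ K B o → (K :* o :+ :- con 0ℚ :- :- (B :* o)) :+ con 0ℚ := (B :+ K) :* o)
                   refl (fromℕ c) (fromℕ b) (ω u v) ⟩
        (fromℕ b + fromℕ c) * ω u v ∎

∈-cliquePairs⁻ : ∀ {c x y} → (x , y) ∈ cliquePairs c → 1 ≤ x × x < y × y ≤ c
∈-cliquePairs⁻ {c} xy∈ =
  let x∈ , y∈ , x<y = ∈-pairsWith⁻ {P = _<ᵇ_} {xs = range 1 c} xy∈
  in proj₁ (∈-range⁻ x∈) , <ᵇ-true⁻ x<y , proj₂ (∈-range⁻ y∈)

length-cliquePairs : ∀ c → length (cliquePairs c) ≡ c C 2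
length-cliquePairs zero    = refl
length-cliquePairs (suc c) = begin
  length (cliquePairs (suc c))
    ≡⟨ cong (length ∘ pairsWith _<ᵇ_) (range-last c) ⟩
  length (pairsWith _<ᵇ_ (range 1 c ++ suc c ∷ []))
    ≡⟨ length-pairsWith-snoc _<ᵇ_ (range 1 c) (suc c) below above ⟩
  length (cliquePairs c) ℕ.+ length (range 1 c)
    ≡⟨ cong₂ ℕ._+_ (length-cliquePairs c) (length-range 1 c) ⟩
  c C 2 ℕ.+ c
    ≡⟨ ℕP.+-comm (c C 2) c ⟩
  c ℕ.+ c C 2
    ≡⟨ cong (ℕ._+ c C 2) (sym (nC1≡n c)) ⟩
  c C 1 ℕ.+ c C 2
    ≡⟨ nCk+nC[k+1]≡[n+1]C[k+1] c 1 ⟩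
  suc c C 2 ∎
  where
  open ≡-Reasoning
  below : ∀ {p} → p ∈ range 1 c → (p <ᵇ suc c) ≡ true
  below p∈ = <ᵇ-true (s≤s (proj₂ (∈-range⁻ p∈)))
  above : ∀ {q} → q ∈ range 1 c ++ suc c ∷ [] → (suc c <ᵇ q) ≡ false
  above q∈ with ∈-++⁻ (range 1 c) q∈
  ... | inj₁ q∈ = <ᵇ-false (ℕP.m≤n⇒m≤1+n (proj₂ (∈-range⁻ q∈)))
  ... | inj₂ (here refl) = <ᵇ-false (ℕP.≤-refl {suc c})

wvec-eigenvector : ∀ c b′ {x y} → 1 ≤ x → x < y → y ≤ c →
  (∃ λ f → f ∈ edges c (suc b′) × wvec c (suc b′) x y f ≢ 0ℚ)
  × (upLap c (suc b′) (wvec c (suc b′) x y) ≐[ c , suc b′ ] (fromℕ (suc b′ ℕ.+ c) ·ᵥ wvec c (suc b′) x y))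
wvec-eigenvector c b′ {x} {y} 1≤x x<y y≤c =
    ((x , y) , clique-edge {c} {suc b′} 1≤x x<y y≤c , nonzero)
  , λ { (u , v) uv∈ → eigen-on-edge c b′ x y 1≤x x<y y≤c uv∈ }
  where
  1≢0 : 1ℚ ≢ 0ℚ
  1≢0 ()
  nonzero : wvec c (suc b′) x y (x , y) ≢ 0ℚ
  nonzero w≡0 = 1≢0 (trans (sym (wvec-at-own-edge c b′ x y 1≤x x<y y≤c)) w≡0)

wvec-linearly-independent : ∀ c b′ (a : ℕ × ℕ → ℚ) →
  sumᵥ (map (λ p → a p ·ᵥ wvec c (suc b′) (proj₁ p) (proj₂ p)) (cliquePairs c)) ≐[ c , suc b′ ] 0ᵥ →
  ∀ p → p ∈ cliquePairs c → a p ≡ 0ℚ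
wvec-linearly-independent c b′ a combination≡0 (x₀ , y₀) p∈ = begin
  a (x₀ , y₀)
    ≡⟨ sym (∑-pairsWith-pick a (range-unique 1 c) p∈) ⟩
  ∑[ p ∈ cliquePairs c ] when (eqE (x₀ , y₀) p) (a p)
    ≡⟨ ∑-cong (cliquePairs c) (λ {p} _ → coefficient p) ⟩
  ∑[ p ∈ cliquePairs c ] (a p ·ᵥ wvec c (suc b′) (proj₁ p) (proj₂ p)) (x₀ , y₀)
    ≡⟨ sym (sumᵥ-map (λ p → a p ·ᵥ wvec c (suc b′) (proj₁ p) (proj₂ p)) (cliquePairs c) (x₀ , y₀)) ⟩
  sumᵥ (map (λ p → a p ·ᵥ wvec c (suc b′) (proj₁ p) (proj₂ p)) (cliquePairs c)) (x₀ , y₀)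
    ≡⟨ combination≡0 (x₀ , y₀) (let 1≤x₀ , x₀<y₀ , y₀≤c = ∈-cliquePairs⁻ p∈
                                 in clique-edge {c} {suc b′} 1≤x₀ x₀<y₀ y₀≤c) ⟩
  0ℚ ∎
  where
  open ≡-Reasoning
  y₀≤c : y₀ ≤ c
  y₀≤c = proj₂ (proj₂ (∈-cliquePairs⁻ p∈))
  coefficient : ∀ p → when (eqE (x₀ , y₀) p) (a p) ≡ a p * wvec c (suc b′) (proj₁ p) (proj₂ p) (x₀ , y₀)
  coefficient p = begin
    when (eqE (x₀ , y₀) p) (a p)
      ≡⟨ sym (𝟙-* (eqE (x₀ , y₀) p) (a p)) ⟩
    𝟙 (eqE (x₀ , y₀) p) * a p
      ≡⟨ ℚP.*-comm _ (a p) ⟩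
    a p * 𝟙 (eqE (x₀ , y₀) p)
      ≡⟨ cong (a p *_) (sym (wvec-on-clique c b′ (proj₁ p) (proj₂ p) x₀ y₀≤c)) ⟩
    a p * wvec c (suc b′) (proj₁ p) (proj₂ p) (x₀ , y₀) ∎

proposition3p22 : (c b : ℕ) → 3 ≤ c → 1 ≤ b →
    -- b + c is an eigenvalue of δ₁ᵀ δ₁
    (∃ λ (v : EVec) → (∃ λ f → f ∈ edges c b × v f ≢ 0ℚ)
       × (upLap c b v ≐[ c , b ] (fromℕ (b ℕ.+ c) ·ᵥ v)))
    -- the family w_{x,y} (x < y in {1..c}) has C(c,2) members
    × length (cliquePairs c) ≡ c C 2
    -- each w_{x,y} is an eigenvector for the eigenvalue b + c
    × (∀ x y → (x , y) ∈ cliquePairs c →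
         (∃ λ f → f ∈ edges c b × wvec c b x y f ≢ 0ℚ)
         × (upLap c b (wvec c b x y) ≐[ c , b ] (fromℕ (b ℕ.+ c) ·ᵥ wvec c b x y)))
    -- the w_{x,y} are linearly independent
    × (∀ (a : ℕ × ℕ → ℚ) →
         sumᵥ (map (λ p → a p ·ᵥ wvec c b (Data.Product.proj₁ p) (Data.Product.proj₂ p)) (cliquePairs c))
           ≐[ c , b ] 0ᵥ →
         ∀ p → p ∈ cliquePairs c → a p ≡ 0ℚ)
proposition3p22 c zero      _   ()
proposition3p22 c (suc b′) 3≤c _ =
    (wvec c (suc b′) 1 2 , wvec-eigenvector c b′ ℕP.≤-refl ℕP.≤-refl (ℕP.≤-trans (ℕP.n≤1+n 2) 3≤c))
  , length-cliquePairs c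
  , (λ x y xy∈ → let 1≤x , x<y , y≤c = ∈-cliquePairs⁻ xy∈ in wvec-eigenvector c b′ 1≤x x<y y≤c)
  , wvec-linearly-independent c b′
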